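{- If $(G,k)$ is a reduced instance of \textsc{Trivially Perfect Editing} and $X$ is a small TP-modulator of $G$, then the number of distinct $X$-neighborhoods, i.e. $|\{N(v)\cap X : v\in V(G)\setminus X\}|$, is $O(k^4)$.
   Context: Graphs are finite, simple, undirected; a graph is trivially perfect if it has no induced $C_4$ or $P_4$. \textsc{Trivially Perfect Editing}: given $(G,k)$, decide if some $S\subseteq\binom{V(G)}{2}$, $|S|\le k$, makes $(V(G),E(G)\triangle S)$ trivially perfect. The instance $(G,k)$ is reduced if neither of the following holds: (i) there is a non-edge $uv$ such that the complement of $G[N(u)\cap N(v)]$ has a matching of size $\ge k+1$; (ii) there is an edge $uv$ and $k+1$ pairwise disjoint non-adjacent pairs $\{a,b\}$ with $a\in N(u)\setminus N[v]$, $b\in N(v)\setminus N[u]$. An obstruction is a 4-vertex set $W$ with $G[W]\cong C_4$ or $P_4$. $X\subseteq V(G)$ is a TP-modulator if every obstruction $W$ has $|W\cap X|\ge2$, and if $|W\cap X|=2$, $W\cap X=\{x_1,x_2\}$, $W\setminus X=\{y_1,y_2\}$, then $G[W]$ is not the $C_4$ $x_1-y_1-y_2-x_2-x_1$ nor the $P_4$ $x_1-y_1-y_2-x_2$; it is small if $|X|\le 4k$. $O(k^4)$ means at most $c\,k^4$ for an absolute constant $c$ (for $k\ge1$). -}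

module Defs where

open import Data.Nat using (ℕ; suc; _+_; _*_; _≤_; _^_)
open import Data.Bool using (Bool; true; false; _∧_; not; if_then_else_)
import Data.Bool as B
open import Data.Fin using (Fin)
open import Data.List using (List; length; map; filter; deduplicate; allFin)
open import Data.Vec using (Vec; tabulate)
open import Data.Vec.Properties using (≡-dec)
open import Data.Product using (_×_; Σ; ∃-syntax; _,_)
open import Relation.Nullary using (¬_)
open import Relation.Nullary.Decidable using (does)
open import Relation.Binary.PropositionalEquality using (_≡_; _≢_)
open import Data.Bool.Properties using (T?)

record Graph (n : ℕ) : Set where
  field
    adj   : Fin n → Fin n → Bool
    sym   : ∀ u v → adj u v ≡ adj v u
    irrefl : ∀ v → adj v v ≡ false
open Graph public

module _ {n : ℕ} (G : Graph n) where

  Edge : Fin n → Fin n → Set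
  Edge u v = adj G u v ≡ true

  NonEdge : Fin n → Fin n → Set
  NonEdge u v = adj G u v ≡ false

  ComplMatching : (m : ℕ) → (Fin n → Set) → (Fin n → Set) → Set
  ComplMatching m Pa Pb =
    Σ (Fin m → Fin n) λ f → Σ (Fin m → Fin n) λ g →
      (∀ i j → f i ≡ f j → i ≡ j) ×
      (∀ i j → g i ≡ g j → i ≡ j) ×
      (∀ i j → f i ≢ g j) ×
      (∀ i → NonEdge (f i) (g i)) ×
      (∀ i → Pa (f i)) × (∀ i → Pb (g i))

  RuleI : ℕ → Set
  RuleI k = ∃[ u ] ∃[ v ] (u ≢ v × NonEdge u v ×
    ComplMatching (suc k) (λ a → Edge u a × Edge v a) (λ b → Edge u b × Edge v b))

  RuleII : ℕ → Set
  RuleII k = ∃[ u ] ∃[ v ] (Edge u v ×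
    ComplMatching (suc k) (λ a → Edge u a × NonEdge v a × a ≢ v)
                          (λ b → Edge v b × NonEdge u b × b ≢ u))

  Reduced : ℕ → Set
  Reduced k = ¬ RuleI k × ¬ RuleII k

  -- a,b,c,d distinct with edges ab, bc, cd and non-edges ac, bd:
  -- exactly the case that G[{a,b,c,d}] is the P4 a-b-c-d (if ad ∉ E)
  -- or the C4 a-b-c-d-a (if ad ∈ E).
  InducedPathOrCycle : Fin n → Fin n → Fin n → Fin n → Set
  InducedPathOrCycle a b c d =
    a ≢ b × a ≢ c × a ≢ d × b ≢ c × b ≢ d × c ≢ d ×
    Edge a b × Edge b c × Edge c d × NonEdge a c × NonEdge b d

VSet : ℕ → Set
VSet n = Fin n → Bool

count : ∀ {n} → VSet n → ℕ
count {n} X = length (filter (λ v → T? (X v)) (allFin n))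

inX : Bool → ℕ
inX true = 1
inX false = 0

module _ {n : ℕ} (G : Graph n) where

  TPModulator : VSet n → Set
  TPModulator X =
    (∀ a b c d → InducedPathOrCycle G a b c d →
       2 ≤ inX (X a) + inX (X b) + inX (X c) + inX (X d)) ×
    (∀ x₁ y₁ y₂ x₂ → X x₁ ≡ true → X x₂ ≡ true → X y₁ ≡ false → X y₂ ≡ false →
       ¬ InducedPathOrCycle G x₁ y₁ y₂ x₂)

  nbhdX : VSet n → Fin n → Vec Bool n
  nbhdX X v = tabulate (λ x → X x ∧ adj G v x)

  numXNeighbourhoods : VSet n → ℕ
  numXNeighbourhoods X =
    length (deduplicate (≡-dec B._≟_)
      (map (nbhdX X) (filter (λ v → T? (not (X v))) (allFin n))))

module Submission where

-- Pick one vertex outside X for every X-neighbourhood, giving a list W, and let m = |X| ≤ 4k.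
-- For each pair x, x′ ∈ X, charge to (x, x′) the middles y of induced paths x − y − x′, and the
-- private neighbours of x with respect to x′ provided there are at most k of them. A greedy pass
-- splits the middles into a matching of non-edges, of size at most k by rule (i), and a clique.
-- No edge y₁y₂ outside X separates two vertices x, z ∈ X both ways (x ∈ N(y₁) ∌ z, z ∈ N(y₂) ∌ x),
-- as x − y₁ − y₂ − z would be an obstruction meeting X in its two ends. Hence the X-neighbourhoods
-- of the clique, and also those of the uncharged vertices of W (where two long private-neighbour
-- lists would give k + 1 pairs for rule (ii)), form a family of distinct sets in which no two points
-- of a common member are separated both ways. Such a family over m points has at most m + 1 members:
-- a nonempty member is the intersection of all members containing its least point for the preorder
-- "every member containing x contains z". So |W| ≤ m²(2k + m + 1) + m²k + m + 1 = O(k⁴).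

open import Defs hiding (sym)
open import Data.Nat using (ℕ; zero; suc; _+_; _*_; _^_; _≤_; z≤n; s≤s)
open import Data.Nat.Properties
  using (_≤?_; ≤-trans; ≤-reflexive; +-mono-≤; +-monoʳ-≤; *-mono-≤; *-monoʳ-≤; *-monoˡ-≤; m≤m*n; ≰⇒>;
         module ≤-Reasoning)
open import Data.Nat.Tactic.RingSolver using (solve-∀)
open import Data.Bool using (Bool; true; false; T; not)
import Data.Bool as Bool
open import Data.Bool.Properties using (T?; ¬-not)
open import Data.Empty using (⊥; ⊥-elim)
open import Data.Fin using (Fin; zero; suc; inject≤; cast)
import Data.Fin as Fin
open import Data.Fin.Properties using (inject≤-injective; toℕ-injective; toℕ-cast; toℕ-inject≤)
open import Data.Fin.Subset using (Subset; ⋂) renaming (⊥ to ∅; _∈_ to _∈ₛ_; _∉_ to _∉ₛ_)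
open import Data.Fin.Subset.Properties using (_∈?_; ∈⊤; x∈p∩q⁺; x∈p∩q⁻; Empty-unique; ⊆-antisym)
open import Data.List using (List; []; _∷_; _++_; length; map; concatMap; filter; lookup; allFin)
open import Data.List.Properties using (length-++; length-map; map-++; ++-assoc)
open import Data.List.Membership.Propositional using (_∈_; find; lose)
open import Data.List.Membership.Propositional.Properties
  using (∈-∃++; ∈-++⁺ˡ; ∈-++⁺ʳ; ∈-++⁻; ∈-map⁺; ∈-map⁻; ∈-filter⁺; ∈-filter⁻; ∈-lookup; ∈-allFin;
         ∈-concatMap⁺; ∈-deduplicate⁻)
import Data.List.Membership.DecPropositional as DecMembership
open import Data.List.Relation.Binary.Permutation.Propositional
  using (_↭_; prep; ↭-refl; ↭-sym; ↭⇒↭ₛ; module PermutationReasoning)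
open import Data.List.Relation.Binary.Permutation.Propositional.Properties
  using (map⁺; shift; ++⁺ˡ; ↭-length; ∈-resp-↭)
open import Data.List.Relation.Binary.Permutation.Setoid.Properties using (Unique-resp-↭)
open import Data.List.Relation.Binary.Pointwise using (Pointwise; []; _∷_)
import Data.List.Relation.Binary.Pointwise as Pointwise
open import Data.List.Relation.Binary.Pointwise.Properties using (Pointwise-length)
open import Data.List.Relation.Binary.Subset.Propositional using (_⊆_)
open import Data.List.Relation.Unary.Any as Any using (Any; here; there; any?)
import Data.List.Relation.Unary.Any.Properties as AnyP
open import Data.List.Relation.Unary.All as All using (All; []; _∷_)
open import Data.List.Relation.Unary.All.Properties using (++⁻; ¬All⇒Any¬; ¬Any⇒All¬)
open import Data.List.Relation.Unary.AllPairs using (AllPairs; []; _∷_)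
import Data.List.Relation.Unary.AllPairs.Properties as AllPairs
open import Data.List.Relation.Unary.Unique.Propositional using (Unique)
import Data.List.Relation.Unary.Unique.Propositional.Properties as Unique
import Data.List.Relation.Unary.Unique.DecPropositional.Properties as UniqueDec
open import Data.Product using (∃-syntax; _×_; _,_; proj₁; proj₂)
open import Data.Sum using (_⊎_; inj₁; inj₂; [_,_]′)
open import Data.Unit using (tt)
open import Data.Vec using (Vec)
open import Data.Vec.Properties using (lookup∘tabulate; []=⇒lookup; lookup⇒[]=; ≡-dec)
open import Function using (_∘_; id; case_of_)
open import Level using (0ℓ)
open import Relation.Binary.Core using (Rel)
open import Relation.Binary.Definitions using (Symmetric; Transitive; DecidableEquality)
open import Relation.Nullary using (¬_; ¬?; Dec; yes; no; contradiction)
open import Relation.Nullary.Decidable using (_×-dec_; _→-dec_)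
open import Relation.Unary using (Pred; Decidable)
open import Relation.Binary.PropositionalEquality

module _ {A : Set} where

  AllPairs-++⁻ : ∀ {R : Rel A 0ℓ} xs {ys} → AllPairs R (xs ++ ys) →
                 AllPairs R xs × AllPairs R ys × All (λ x → All (R x) ys) xs
  AllPairs-++⁻ []       rys          = [] , rys , []
  AllPairs-++⁻ (x ∷ xs) (rx ∷ rxsys) =
    let rxs , rys , rxsys′ = AllPairs-++⁻ xs rxsys
        rxxs , rxys = ++⁻ xs rx
    in rxxs ∷ rxs , rys , rxys ∷ rxsys′

  Unique-++⁻ : ∀ xs {ys} → Unique (xs ++ ys) →
               Unique xs × Unique ys × (∀ {x y} → x ∈ xs → y ∈ ys → x ≢ y)
  Unique-++⁻ xs uxsys =
    let uxs , uys , disj = AllPairs-++⁻ xs uxsys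
    in uxs , uys , λ x∈xs y∈ys → All.lookup (All.lookup disj x∈xs) y∈ys

  ∈-++-remove : ∀ {v x : A} ys {zs} → v ∈ ys ++ x ∷ zs → v ≢ x → v ∈ ys ++ zs
  ∈-++-remove ys v∈ v≢x with ∈-++⁻ ys v∈
  ... | inj₁ v∈ys         = ∈-++⁺ˡ v∈ys
  ... | inj₂ (here v≡x)   = contradiction v≡x v≢x
  ... | inj₂ (there v∈zs) = ∈-++⁺ʳ ys v∈zs

  Unique-⊆⇒length≤ : ∀ {xs ys : List A} → Unique xs → xs ⊆ ys → length xs ≤ length ys
  Unique-⊆⇒length≤ {[]}     _            _     = z≤n
  Unique-⊆⇒length≤ {x ∷ xs} (x∉xs ∷ uxs) xs⊆ys
    with ys₁ , ys₂ , refl ← ∈-∃++ (xs⊆ys (here refl)) = ≤-trans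
      (s≤s (Unique-⊆⇒length≤ uxs λ v∈xs →
        ∈-++-remove ys₁ (xs⊆ys (there v∈xs)) (≢-sym (All.lookup x∉xs v∈xs))))
      (≤-reflexive (sym (length-∷-middle ys₁)))
    where
    length-∷-middle : ∀ ys {zs} → length (ys ++ x ∷ zs) ≡ suc (length (ys ++ zs))
    length-∷-middle []       = refl
    length-∷-middle (_ ∷ ys) = cong suc (length-∷-middle ys)

  lookup-injective : ∀ {xs : List A} → Unique xs → ∀ {i j} → lookup xs i ≡ lookup xs j → i ≡ j
  lookup-injective {_ ∷ _} _            {zero}  {zero}  _  = refl
  lookup-injective {_ ∷ _} (x∉xs ∷ _)   {zero}  {suc j} eq = ⊥-elim (All.lookup x∉xs (∈-lookup j) eq)
  lookup-injective {_ ∷ _} (x∉xs ∷ _)   {suc i} {zero}  eq = ⊥-elim (All.lookup x∉xs (∈-lookup i) (sym eq))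
  lookup-injective {_ ∷ _} (_ ∷ uxs)    {suc i} {suc j} eq = cong suc (lookup-injective uxs eq)

  AllPairs-remove : ∀ {R : Rel A 0ℓ} xs {y ys} → AllPairs R (xs ++ y ∷ ys) → AllPairs R (xs ++ ys)
  AllPairs-remove xs rxsyys with AllPairs-++⁻ xs rxsyys
  ... | rxs , _ ∷ rys , cross = AllPairs.++⁺ rxs rys (All.map All.tail cross)

  ⊆-++-filter-∉ : (_≟_ : DecidableEquality A) → ∀ ys xs →
                  xs ⊆ ys ++ filter (λ x → ¬? (DecMembership._∈?_ _≟_ x ys)) xs
  ⊆-++-filter-∉ _≟_ ys xs {x} x∈xs with DecMembership._∈?_ _≟_ x ys
  ... | yes x∈ys = ∈-++⁺ˡ x∈ys
  ... | no  x∉ys = ∈-++⁺ʳ ys (∈-filter⁺ _ x∈xs x∉ys)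

  AllPairs-lookup : ∀ {R : Rel A 0ℓ} → Symmetric R → ∀ {xs x y} → AllPairs R xs →
                    x ∈ xs → y ∈ xs → x ≢ y → R x y
  AllPairs-lookup sym (rx ∷ _)   (here refl) (here refl) x≢y = contradiction refl x≢y
  AllPairs-lookup sym (rx ∷ _)   (here refl) (there y∈)  _   = All.lookup rx y∈
  AllPairs-lookup sym (rx ∷ _)   (there x∈)  (here refl) _   = sym (All.lookup rx x∈)
  AllPairs-lookup sym (_ ∷ rxs)  (there x∈)  (there y∈)  x≢y = AllPairs-lookup sym rxs x∈ y∈ x≢y

  nonempty : ∀ {xs : List A} {k} → suc k ≤ length xs → ∃[ x ] x ∈ xs
  nonempty {x ∷ _} _ = x , here refl

  dropIfLonger : ℕ → List A → List A
  dropIfLonger k xs with length xs ≤? k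
  ... | yes _ = xs
  ... | no  _ = []

  length-dropIfLonger : ∀ k xs → length (dropIfLonger k xs) ≤ k
  length-dropIfLonger k xs with length xs ≤? k
  ... | yes |xs|≤k = |xs|≤k
  ... | no  _      = z≤n

  ∈-dropIfLonger : ∀ {k xs x} → length xs ≤ k → x ∈ xs → x ∈ dropIfLonger k xs
  ∈-dropIfLonger {k} {xs} |xs|≤k x∈xs with length xs ≤? k
  ... | yes _      = x∈xs
  ... | no  |xs|≰k = contradiction |xs|≤k |xs|≰k

module _ {A B : Set} where

  length-concatMap-≤ : ∀ (f : A → List B) {b} xs → (∀ {x} → x ∈ xs → length (f x) ≤ b) →
                       length (concatMap f xs) ≤ length xs * b
  length-concatMap-≤ f []       _ = z≤n
  length-concatMap-≤ f (x ∷ xs) h = ≤-trans (≤-reflexive (length-++ (f x)))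
    (+-mono-≤ (h (here refl)) (length-concatMap-≤ f xs (h ∘ there)))

  map-preimage : ∀ (f : A → B) {xs} ys → ys ⊆ map f xs → ∃[ zs ] zs ⊆ xs × map f zs ≡ ys
  map-preimage f []       _  = [] , (λ ()) , refl
  map-preimage f (y ∷ ys) ⊆f with ∈-map⁻ f (⊆f (here refl)) | map-preimage f ys (⊆f ∘ there)
  ... | z , z∈xs , refl | zs , zs⊆xs , refl =
    z ∷ zs , (λ { (here refl) → z∈xs ; (there v) → zs⊆xs v }) , refl

  Unique-map-filter⁺ : ∀ {f : A → B} {P : Pred A 0ℓ} (P? : Decidable P) {xs} →
                       Unique (map f xs) → Unique (map f (filter P? xs))
  Unique-map-filter⁺ P? = AllPairs.map⁺ ∘ AllPairs.filter⁺ P? ∘ AllPairs.map⁻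

  Unique-map-++⁻ : ∀ (f : A → B) xs {ys} → Unique (map f (xs ++ ys)) →
                   Unique (map f xs) × Unique (map f ys)
  Unique-map-++⁻ f xs {ys} u with Unique-++⁻ (map f xs) (subst Unique (map-++ f xs ys) u)
  ... | uxs , uys , _ = uxs , uys

  Unique-map-resp-↭ : ∀ (f : A → B) {xs ys} → xs ↭ ys → Unique (map f ys) → Unique (map f xs)
  Unique-map-resp-↭ f xs↭ys = Unique-resp-↭ (setoid B) (↭⇒↭ₛ (map⁺ f (↭-sym xs↭ys)))

-- Unseparated families of subsets

module _ {A : Set} {P : Pred A 0ℓ} {_≼_ : Rel A 0ℓ} (P? : Decidable P) (≼-trans : Transitive _≼_)
         (≼-total : ∀ {a b} → P a → P b → a ≼ b ⊎ b ≼ a) where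

  private
    ≼-refl : ∀ {a} → P a → a ≼ a
    ≼-refl pa = [ id , id ]′ (≼-total pa pa)

  least : ∀ xs → (∃[ a ] P a × All (λ b → P b → a ≼ b) xs) ⊎ All (¬_ ∘ P) xs
  least []       = inj₂ []
  least (x ∷ xs) with P? x | least xs
  ... | no ¬px | inj₁ (a , pa , a≼) = inj₁ (a , pa , (λ px → contradiction px ¬px) ∷ a≼)
  ... | no ¬px | inj₂ none          = inj₂ (¬px ∷ none)
  ... | yes px | inj₂ none          =
    inj₁ (x , px , (λ _ → ≼-refl px) ∷ All.map (λ ¬pb pb → contradiction pb ¬pb) none)
  ... | yes px | inj₁ (a , pa , a≼) with ≼-total pa px
  ...   | inj₁ a≼x = inj₁ (a , pa , (λ _ → a≼x) ∷ a≼)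
  ...   | inj₂ x≼a = inj₁ (x , px , (λ _ → ≼-refl px) ∷ All.map (λ a≼b pb → ≼-trans x≼a (a≼b pb)) a≼)

module _ {n : ℕ} where

  ∈-⋂⁺ : ∀ {x : Fin n} {ps} → All (x ∈ₛ_) ps → x ∈ₛ ⋂ ps
  ∈-⋂⁺ []         = ∈⊤
  ∈-⋂⁺ (x∈p ∷ hs) = x∈p∩q⁺ (x∈p , ∈-⋂⁺ hs)

  ∈-⋂⁻ : ∀ {x : Fin n} ps → x ∈ₛ ⋂ ps → All (x ∈ₛ_) ps
  ∈-⋂⁻ []       _ = []
  ∈-⋂⁻ (p ∷ ps) h = let x∈p , x∈⋂ps = x∈p∩q⁻ p (⋂ ps) h in x∈p ∷ ∈-⋂⁻ ps x∈⋂ps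

  Splits : Fin n → Fin n → Subset n → Set
  Splits x z q = x ∈ₛ q × z ∉ₛ q

  Unseparated : List (Subset n) → Set
  Unseparated F = ∀ {p x z} → p ∈ F → x ∈ₛ p → z ∈ₛ p → ¬ (Any (Splits x z) F × Any (Splits z x) F)

  module _ (F : List (Subset n)) where

    private
      _≼_ : Rel (Fin n) 0ℓ
      x ≼ z = All (λ q → x ∈ₛ q → z ∈ₛ q) F

      meet : Fin n → Subset n
      meet x = ⋂ (filter (x ∈?_) F)

      ≼-trans : Transitive _≼_
      ≼-trans x≼y y≼z = All.zipWith (λ (x⇒y , y⇒z) → y⇒z ∘ x⇒y) (x≼y , y≼z)

      splits : ∀ {x z} → ¬ x ≼ z → Any (Splits x z) F
      splits {x} {z} = Any.map split ∘ ¬All⇒Any¬ (λ q → x ∈? q →-dec z ∈? q) F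
        where
        split : ∀ {q} → ¬ (x ∈ₛ q → z ∈ₛ q) → Splits x z q
        split {q} ¬x⇒z with x ∈? q
        ... | yes x∈q = x∈q , λ z∈q → ¬x⇒z λ _ → z∈q
        ... | no  x∉q = contradiction (λ x∈q → contradiction x∈q x∉q) ¬x⇒z

      ≼-total : Unseparated F → ∀ {p} → p ∈ F → ∀ {x z} → x ∈ₛ p → z ∈ₛ p → x ≼ z ⊎ z ≼ x
      ≼-total unsep p∈F {x} {z} x∈p z∈p with All.all? (λ q → x ∈? q →-dec z ∈? q) F
                                          | All.all? (λ q → z ∈? q →-dec x ∈? q) F
      ... | yes x≼z | _       = inj₁ x≼z
      ... | no _    | yes z≼x = inj₂ z≼x
      ... | no x⋠z  | no z⋠x  = contradiction (splits x⋠z , splits z⋠x) (unsep p∈F x∈p z∈p)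

      meet-least : ∀ {p x} → p ∈ F → x ∈ₛ p → (∀ {z} → z ∈ₛ p → x ≼ z) → p ≡ meet x
      meet-least {p} {x} p∈F x∈p x≼ = ⊆-antisym
        (λ z∈p → ∈-⋂⁺ (All.tabulate λ q∈ →
          let q∈F , x∈q = ∈-filter⁻ (x ∈?_) q∈ in All.lookup (x≼ z∈p) q∈F x∈q))
        (λ z∈meet → All.lookup (∈-⋂⁻ _ z∈meet) (∈-filter⁺ (x ∈?_) p∈F x∈p))

    Unseparated-length≤ : Unique F → Unseparated F → (xs : List (Fin n)) →
                          (∀ {p x} → p ∈ F → x ∈ₛ p → x ∈ xs) → length F ≤ suc (length xs)
    Unseparated-length≤ uniq unsep xs cover = ≤-trans
      (Unique-⊆⇒length≤ uniq F⊆)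
      (≤-reflexive (cong suc (length-map meet xs)))
      where
      F⊆ : ∀ {p} → p ∈ F → p ∈ ∅ ∷ map meet xs
      F⊆ {p} p∈F with least (_∈? p) ≼-trans (≼-total unsep p∈F) (allFin n)
      ... | inj₂ none = here (Empty-unique λ (x , x∈p) → All.lookup none (∈-allFin x) x∈p)
      ... | inj₁ (x , x∈p , x≼) = there (subst (_∈ map meet xs)
              (sym (meet-least p∈F x∈p λ {z} z∈p → All.lookup x≼ (∈-allFin z) z∈p))
              (∈-map⁺ meet (cover p∈F x∈p)))

-- Co-matchings and cliques

module _ {n : ℕ} (G : Graph n) where

  Edge-sym : Symmetric (Edge G)
  Edge-sym {u} {v} = trans (Graph.sym G v u)

  NonEdge-sym : Symmetric (NonEdge G)
  NonEdge-sym {u} {v} = trans (Graph.sym G v u)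

  InducedP₃ : Fin n → Fin n → Fin n → Set
  InducedP₃ x x′ y = x ≢ x′ × NonEdge G x x′ × Edge G x y × Edge G x′ y

  inducedP₃? : ∀ x x′ → Decidable (InducedP₃ x x′)
  inducedP₃? x x′ y = ¬? (x Fin.≟ x′) ×-dec adj G x x′ Bool.≟ false
                      ×-dec adj G x y Bool.≟ true ×-dec adj G x′ y Bool.≟ true

  Private : Fin n → Fin n → Fin n → Set
  Private x x′ y = Edge G x y × NonEdge G x′ y

  private? : ∀ x x′ → Decidable (Private x x′)
  private? x x′ y = adj G x y Bool.≟ true ×-dec adj G x′ y Bool.≟ false

  record CoMatchingAndClique (T : List (Fin n)) : Set where
    field
      as bs U    : List (Fin n)
      partition  : as ++ bs ++ U ↭ T
      coMatching : Pointwise (NonEdge G) as bs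
      clique     : AllPairs (Edge G) U

    length-partition : length T ≡ length as + (length as + length U)
    length-partition = begin
      length T                            ≡⟨ ↭-length partition ⟨
      length (as ++ bs ++ U)              ≡⟨ length-++ as ⟩
      length as + length (bs ++ U)        ≡⟨ cong (length as +_) (length-++ bs) ⟩
      length as + (length bs + length U)  ≡⟨ cong (λ l → length as + (l + length U))
                                                    (Pointwise-length coMatching) ⟨
      length as + (length as + length U)  ∎
      where open ≡-Reasoning

    coMatched⊆ : as ++ bs ⊆ T
    coMatched⊆ = ∈-resp-↭ partition ∘ subst (_ ∈_) (++-assoc as bs U) ∘ ∈-++⁺ˡ

    clique⊆ : U ⊆ T
    clique⊆ = ∈-resp-↭ partition ∘ ∈-++⁺ʳ as ∘ ∈-++⁺ʳ bs

    unique-partition : ∀ {B : Set} (f : Fin n → B) → Unique (map f T) →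
                       Unique (as ++ bs) × Unique (map f U)
    unique-partition f uT =
      Unique.map⁻ (proj₁ (Unique-map-++⁻ f (as ++ bs) (subst (Unique ∘ map f) (sym (++-assoc as bs U)) u)))
      , proj₂ (Unique-map-++⁻ f bs (proj₂ (Unique-map-++⁻ f as u)))
      where u = Unique-map-resp-↭ f partition uT

  coMatchingAndClique : ∀ T → CoMatchingAndClique T
  coMatchingAndClique [] = record
    { as = [] ; bs = [] ; U = [] ; partition = ↭-refl ; coMatching = [] ; clique = [] }
  coMatchingAndClique (z ∷ T) with coMatchingAndClique T
  ... | record { as = as ; bs = bs ; U = U ; partition = π ; coMatching = μ ; clique = κ }
    with any? (λ u → adj G z u Bool.≟ false) U
  ... | no ∄nonNeighbour = record
    { as = as ; bs = bs ; U = z ∷ U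
    ; partition = begin
        as ++ bs ++ z ∷ U      ≡⟨ ++-assoc as bs (z ∷ U) ⟨
        (as ++ bs) ++ z ∷ U    ↭⟨ shift z (as ++ bs) U ⟩
        z ∷ ((as ++ bs) ++ U)  ≡⟨ cong (z ∷_) (++-assoc as bs U) ⟩
        z ∷ (as ++ bs ++ U)    ↭⟨ prep z π ⟩
        z ∷ T                  ∎
    ; coMatching = μ
    ; clique = All.map ¬-not (¬Any⇒All¬ U ∄nonNeighbour) ∷ κ
    }
    where open PermutationReasoning
  ... | yes ∃nonNeighbour
    with u , u∈U , z≁u ← find ∃nonNeighbour
    with U₁ , U₂ , refl ← ∈-∃++ u∈U = record
    { as = z ∷ as ; bs = u ∷ bs ; U = U₁ ++ U₂
    ; partition = begin
        z ∷ (as ++ u ∷ bs ++ U₁ ++ U₂)  ↭⟨ prep z (++⁺ˡ as (begin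
          u ∷ (bs ++ U₁ ++ U₂)          ≡⟨ cong (u ∷_) (++-assoc bs U₁ U₂) ⟨
          u ∷ ((bs ++ U₁) ++ U₂)        ↭⟨ shift u (bs ++ U₁) U₂ ⟨
          (bs ++ U₁) ++ u ∷ U₂          ≡⟨ ++-assoc bs U₁ (u ∷ U₂) ⟩
          bs ++ U₁ ++ u ∷ U₂            ∎)) ⟩
        z ∷ (as ++ bs ++ U₁ ++ u ∷ U₂)  ↭⟨ prep z π ⟩
        z ∷ T                           ∎
    ; coMatching = z≁u ∷ μ
    ; clique = AllPairs-remove U₁ κ
    }
    where open PermutationReasoning

  coMatching⇒ComplMatching : ∀ {m Pa Pb} as bs → Unique (as ++ bs) →
    (m≤as : m ≤ length as) (m≤bs : m ≤ length bs) →
    (∀ i → NonEdge G (lookup as (inject≤ i m≤as)) (lookup bs (inject≤ i m≤bs))) →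
    All Pa as → All Pb bs → ComplMatching G m Pa Pb
  coMatching⇒ComplMatching as bs uniq m≤as m≤bs nonEdge pas pbs
    with uas , ubs , disjoint ← Unique-++⁻ as uniq =
      (λ i → lookup as (inject≤ i m≤as)) , (λ i → lookup bs (inject≤ i m≤bs))
    , (λ i j eq → inject≤-injective _ _ i j (lookup-injective uas eq))
    , (λ i j eq → inject≤-injective _ _ i j (lookup-injective ubs eq))
    , (λ i j → disjoint (∈-lookup _) (∈-lookup _))
    , nonEdge
    , (λ i → All.lookup pas (∈-lookup _))
    , (λ i → All.lookup pbs (∈-lookup _))

  Pointwise⇒ComplMatching : ∀ {m Pa Pb as bs} → Pointwise (NonEdge G) as bs → Unique (as ++ bs) →
                            m ≤ length as → All Pa as → All Pb bs → ComplMatching G m Pa Pb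
  Pointwise⇒ComplMatching {as = as} {bs} μ uniq m≤as =
    coMatching⇒ComplMatching as bs uniq m≤as m≤bs λ i →
      subst (NonEdge G _ ∘ lookup bs) (same-index i) (Pointwise.lookup⁺ μ (inject≤ i m≤as))
    where
    m≤bs = subst (_ ≤_) (Pointwise-length μ) m≤as
    same-index : ∀ i → cast (Pointwise-length μ) (inject≤ i m≤as) ≡ inject≤ i m≤bs
    same-index i = toℕ-injective (trans (toℕ-cast _ _)
      (trans (toℕ-inject≤ i m≤as) (sym (toℕ-inject≤ i m≤bs))))

  long-coMatching⇒RuleI : ∀ {k x x′ as bs} → Pointwise (NonEdge G) as bs → Unique (as ++ bs) →
                          (∀ {y} → y ∈ as ++ bs → InducedP₃ x x′ y) → suc k ≤ length as → RuleI G k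
  long-coMatching⇒RuleI {x = x} {x′} {as} {bs} μ uniq P₃ long
    with a , a∈as ← nonempty {xs = as} long
    with x≢x′ , xx′ , _ ← P₃ (∈-++⁺ˡ a∈as) =
    x , x′ , x≢x′ , xx′ ,
    Pointwise⇒ComplMatching μ uniq long
      (All.tabulate (common ∘ ∈-++⁺ˡ)) (All.tabulate (common ∘ ∈-++⁺ʳ as))
    where
    common : ∀ {y} → y ∈ as ++ bs → Edge G x y × Edge G x′ y
    common = proj₂ ∘ proj₂ ∘ P₃

-- X-neighbourhoods

module _ {n : ℕ} (G : Graph n) (X : VSet n) where

  ∈-nbhdX⁻ : ∀ {x y} → x ∈ₛ nbhdX G X y → X x ≡ true × Edge G y x
  ∈-nbhdX⁻ {x} x∈ = ∧-true (trans (sym (lookup∘tabulate _ x)) ([]=⇒lookup x∈))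
    where
    ∧-true : ∀ {a b} → a Bool.∧ b ≡ true → a ≡ true × b ≡ true
    ∧-true {true} {true} _ = refl , refl

  ∈-nbhdX⁺ : ∀ {x y} → X x ≡ true → Edge G y x → x ∈ₛ nbhdX G X y
  ∈-nbhdX⁺ {x} Xx yx = lookup⇒[]= x _ (trans (lookup∘tabulate _ x) (cong₂ Bool._∧_ Xx yx))

  ∉-nbhdX : ∀ {x y} → X x ≡ true → x ∉ₛ nbhdX G X y → NonEdge G y x
  ∉-nbhdX Xx x∉ = ¬-not (x∉ ∘ ∈-nbhdX⁺ Xx)

  in≢out : ∀ {x y} → X x ≡ true → X y ≡ false → x ≢ y
  in≢out Xx Xy refl = contradiction (trans (sym Xx) Xy) λ ()

  private⇒splits : ∀ {x x′ y} → X x ≡ true → Private G x x′ y → Splits x x′ (nbhdX G X y)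
  private⇒splits Xx (xy , x′y) = ∈-nbhdX⁺ Xx (Edge-sym G xy) ,
    λ x′∈ → contradiction (trans (sym (proj₂ (∈-nbhdX⁻ x′∈))) (NonEdge-sym G x′y)) λ ()

  splits⇒private : ∀ {x x′ y} → X x′ ≡ true → Splits x x′ (nbhdX G X y) → Private G x x′ y
  splits⇒private Xx′ (x∈ , x′∉) = Edge-sym G (proj₂ (∈-nbhdX⁻ x∈)) , NonEdge-sym G (∉-nbhdX Xx′ x′∉)

  -- length Xs is count X by definition.
  Xs : List (Fin n)
  Xs = filter (T? ∘ X) (allFin n)

  ∈-Xs : ∀ {x} → X x ≡ true → x ∈ Xs
  ∈-Xs {x} Xx = ∈-filter⁺ (T? ∘ X) (∈-allFin x) (subst T (sym Xx) tt)

  traces-length≤ : ∀ {L} → Unique (map (nbhdX G X) L) → Unseparated (map (nbhdX G X) L) →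
                   length L ≤ suc (length Xs)
  traces-length≤ {L} uL unsep = subst (_≤ suc (length Xs)) (length-map _ L)
    (Unseparated-length≤ _ uL unsep Xs λ p∈ x∈p → case ∈-map⁻ _ p∈ of λ where
      (_ , _ , refl) → ∈-Xs (proj₁ (∈-nbhdX⁻ x∈p)))

  overPairs : (Fin n → Fin n → List (Fin n)) → List (Fin n)
  overPairs f = concatMap (λ x → concatMap (f x) Xs) Xs

  length-overPairs : ∀ f {b} → (∀ {x x′} → length (f x x′) ≤ b) →
                     length (overPairs f) ≤ length Xs * (length Xs * b)
  length-overPairs f h = length-concatMap-≤ _ Xs λ _ → length-concatMap-≤ _ Xs λ _ → h

  ∈-overPairs : ∀ f {x x′ y} → X x ≡ true → X x′ ≡ true → y ∈ f x x′ → y ∈ overPairs f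
  ∈-overPairs f Xx Xx′ y∈ = ∈-concatMap⁺ _ (lose (∈-Xs Xx) (∈-concatMap⁺ _ (lose (∈-Xs Xx′) y∈)))

  module _ (tp : TPModulator G X) where

    no-separating-edge : ∀ {x z y y′} → X y ≡ false → X y′ ≡ false → Edge G y y′ →
                         Splits x z (nbhdX G X y) → Splits z x (nbhdX G X y′) → ⊥
    no-separating-edge {x} {z} {y} {y′} Xy Xy′ yy′ (x∈y , z∉y) (z∈y′ , x∉y′)
      with Xx , yx ← ∈-nbhdX⁻ x∈y | Xz , y′z ← ∈-nbhdX⁻ z∈y′ =
      proj₂ tp x y y′ z Xx Xz Xy Xy′
        ( in≢out Xx Xy , in≢out Xx Xy′ , (λ { refl → z∉y x∈y })
        , (λ { refl → contradiction (trans (sym yy′) (irrefl G y)) λ () })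
        , ≢-sym (in≢out Xz Xy) , ≢-sym (in≢out Xz Xy′)
        , Edge-sym G yx , yy′ , y′z , NonEdge-sym G (∉-nbhdX Xx x∉y′) , ∉-nbhdX Xz z∉y )

    clique-unseparated : ∀ {U} → AllPairs (Edge G) U → All (λ y → X y ≡ false) U →
                         Unseparated (map (nbhdX G X) U)
    clique-unseparated κ outU _ _ _ (sep₁ , sep₂)
      with y₁ , y₁∈ , s₁ ← find (AnyP.map⁻ sep₁) | y₂ , y₂∈ , s₂ ← find (AnyP.map⁻ sep₂) =
      no-separating-edge (All.lookup outU y₁∈) (All.lookup outU y₂∈)
        (AllPairs-lookup (Edge-sym G) κ y₁∈ y₂∈ λ { refl → proj₂ s₂ (proj₁ s₁) }) s₁ s₂

    module _ (k : ℕ) (reduced : Reduced G k) (W : List (Fin n))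
             (distinct : Unique (map (nbhdX G X) W)) (outside : All (λ y → X y ≡ false) W) where

      P₃-middles-≤ : ∀ x x′ → length (filter (inducedP₃? G x x′) W) ≤ k + (k + suc (length Xs))
      P₃-middles-≤ x x′ = begin
        length middles                      ≡⟨ length-partition ⟩
        length as + (length as + length U)  ≤⟨ +-mono-≤ as≤k (+-mono-≤ as≤k (traces-length≤ uU
                                                 (clique-unseparated clique (All.tabulate outU)))) ⟩
        k + (k + suc (length Xs))           ∎
        where
        open ≤-Reasoning
        middles = filter (inducedP₃? G x x′) W
        open CoMatchingAndClique (coMatchingAndClique G middles)
        inMiddles : ∀ {y} → y ∈ middles → y ∈ W × InducedP₃ G x x′ y
        inMiddles = ∈-filter⁻ (inducedP₃? G x x′) {xs = W}
        uAB = proj₁ (unique-partition (nbhdX G X) (Unique-map-filter⁺ _ distinct))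
        uU = proj₂ (unique-partition (nbhdX G X) (Unique-map-filter⁺ _ distinct))
        outU : ∀ {y} → y ∈ U → X y ≡ false
        outU = All.lookup outside ∘ proj₁ ∘ inMiddles ∘ clique⊆
        as≤k : length as ≤ k
        as≤k with length as ≤? k
        ... | yes as≤k = as≤k
        ... | no  as≰k = ⊥-elim (proj₁ reduced
                (long-coMatching⇒RuleI G coMatching uAB (proj₂ ∘ inMiddles ∘ coMatched⊆) (≰⇒> as≰k)))

      long-private⇒RuleII : ∀ {x z} → Edge G x z → X x ≡ true → X z ≡ true →
                            suc k ≤ length (filter (private? G x z) W) →
                            suc k ≤ length (filter (private? G z x) W) → RuleII G k
      long-private⇒RuleII {x} {z} xz Xx Xz long₁ long₂ =
        x , z , xz , coMatching⇒ComplMatching G as bs uniq long₁ long₂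
          (λ _ → nonEdge (∈-lookup _) (∈-lookup _))
          (All.tabulate (condition Xz ∘ inAs)) (All.tabulate (condition Xx ∘ inBs))
        where
        as = filter (private? G x z) W
        bs = filter (private? G z x) W
        inAs : ∀ {y} → y ∈ as → y ∈ W × Private G x z y
        inAs = ∈-filter⁻ (private? G x z) {xs = W}
        inBs : ∀ {y} → y ∈ bs → y ∈ W × Private G z x y
        inBs = ∈-filter⁻ (private? G z x) {xs = W}
        uniqueW = Unique.map⁻ distinct
        uniq : Unique (as ++ bs)
        uniq = Unique.++⁺ (Unique.filter⁺ _ uniqueW) (Unique.filter⁺ _ uniqueW) λ (y∈as , y∈bs) →
          contradiction (trans (sym (proj₁ (proj₂ (inAs y∈as)))) (proj₂ (proj₂ (inBs y∈bs)))) λ ()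
        nonEdge : ∀ {c d} → c ∈ as → d ∈ bs → NonEdge G c d
        nonEdge {c} {d} c∈ d∈ with adj G c d in cd
        ... | false = refl
        ... | true  = ⊥-elim (no-separating-edge
                        (All.lookup outside (proj₁ (inAs c∈))) (All.lookup outside (proj₁ (inBs d∈))) cd
                        (private⇒splits Xx (proj₂ (inAs c∈))) (private⇒splits Xz (proj₂ (inBs d∈))))
        condition : ∀ {u v y} → X v ≡ true → y ∈ W × Private G u v y → Edge G u y × NonEdge G v y × y ≢ v
        condition Xv (y∈W , uy , vy) = uy , vy , ≢-sym (in≢out Xv (All.lookup outside y∈W))

      p₃Middles rarePrivates remaining : List (Fin n)
      p₃Middles    = overPairs (λ x x′ → filter (inducedP₃? G x x′) W)
      rarePrivates = overPairs (λ x x′ → dropIfLonger k (filter (private? G x x′) W))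
      remaining    = filter (λ y → ¬? (DecMembership._∈?_ Fin._≟_ y (p₃Middles ++ rarePrivates))) W

      private
        ∈-remaining⁻ : ∀ {y} → y ∈ remaining → y ∈ W × ¬ y ∈ p₃Middles ++ rarePrivates
        ∈-remaining⁻ = ∈-filter⁻ _ {xs = W}

      private-long : ∀ {x z y} → X x ≡ true → X z ≡ true → y ∈ remaining → Private G x z y →
                     suc k ≤ length (filter (private? G x z) W)
      private-long {x} {z} Xx Xz y∈ xzy with length (filter (private? G x z) W) ≤? k
      ... | no  ≰k = ≰⇒> ≰k
      ... | yes ≤k = contradiction
        (∈-++⁺ʳ p₃Middles (∈-overPairs _ Xx Xz
          (∈-dropIfLonger ≤k (∈-filter⁺ _ (proj₁ (∈-remaining⁻ y∈)) xzy))))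
        (proj₂ (∈-remaining⁻ y∈))

      -- Two X-neighbours x, z of a remaining vertex are adjacent (else it is a middle of x − y − z),
      -- and remaining vertices separating them both ways make both private-neighbour lists long.
      remaining-unseparated : Unseparated (map (nbhdX G X) remaining)
      remaining-unseparated {_} {x} {z} p∈ x∈p z∈p (sep₁ , sep₂)
        with y , y∈ , refl ← ∈-map⁻ _ p∈
        with Xx , yx ← ∈-nbhdX⁻ x∈p | Xz , yz ← ∈-nbhdX⁻ z∈p
        with y₁ , y₁∈ , s₁ ← find (AnyP.map⁻ sep₁) | y₂ , y₂∈ , s₂ ← find (AnyP.map⁻ sep₂)
        with adj G x z in xz
      ... | false = proj₂ (∈-remaining⁻ y∈) (∈-++⁺ˡ (∈-overPairs _ Xx Xz
                      (∈-filter⁺ _ (proj₁ (∈-remaining⁻ y∈))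
                        ((λ { refl → proj₂ s₁ (proj₁ s₁) }) , xz , Edge-sym G yx , Edge-sym G yz))))
      ... | true  = proj₂ reduced (long-private⇒RuleII xz Xx Xz
                      (private-long Xx Xz y₁∈ (splits⇒private Xz s₁))
                      (private-long Xz Xx y₂∈ (splits⇒private Xx s₂)))

      length-representatives≤ : length W ≤ length Xs * (length Xs * (k + (k + suc (length Xs))))
                                          + length Xs * (length Xs * k) + suc (length Xs)
      length-representatives≤ = begin
        length W
          ≤⟨ Unique-⊆⇒length≤ (Unique.map⁻ distinct)
               (⊆-++-filter-∉ Fin._≟_ (p₃Middles ++ rarePrivates) W) ⟩
        length ((p₃Middles ++ rarePrivates) ++ remaining)
          ≡⟨ length-++ (p₃Middles ++ rarePrivates) ⟩
        length (p₃Middles ++ rarePrivates) + length remaining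
          ≡⟨ cong (_+ length remaining) (length-++ p₃Middles) ⟩
        length p₃Middles + length rarePrivates + length remaining
          ≤⟨ +-mono-≤ (+-mono-≤ (length-overPairs _ (P₃-middles-≤ _ _))
                                (length-overPairs _ λ {x} {x′} →
                                   length-dropIfLonger k (filter (private? G x x′) W)))
                      (traces-length≤ (Unique-map-filter⁺ _ distinct) remaining-unseparated) ⟩
        _ ∎
        where open ≤-Reasoning

module _ {n : ℕ} (G : Graph n) (X : VSet n) where

  private
    _≟_ : (p q : Vec Bool n) → Dec (p ≡ q)
    _≟_ = ≡-dec Bool._≟_

    outsideX : List (Fin n)
    outsideX = filter (λ v → T? (not (X v))) (allFin n)

    T-not : ∀ {b} → T (not b) → b ≡ false
    T-not {false} _ = refl

  neighbourhood-representatives : ∃[ W ] Unique (map (nbhdX G X) W) × All (λ y → X y ≡ false) W ×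
                                         length W ≡ numXNeighbourhoods G X
  neighbourhood-representatives
    with W , W⊆ , traces≡ ← map-preimage (nbhdX G X) _ (∈-deduplicate⁻ _≟_ (map (nbhdX G X) outsideX)) =
    W , subst Unique (sym traces≡) (UniqueDec.deduplicate-! _≟_ _) ,
    All.tabulate (λ y∈ → T-not (proj₂ (∈-filter⁻ (λ v → T? (not (X v))) {xs = allFin n} (W⊆ y∈)))) ,
    trans (sym (length-map _ W)) (cong length traces≡)

polynomial-bound : ∀ {k m} → 1 ≤ k → m ≤ 4 * k →
                   m * (m * (k + (k + suc m))) + m * (m * k) + suc m ≤ 133 * k ^ 4
polynomial-bound {k@(suc _)} {m} 1≤k m≤4k = begin
  m * (m * (k + (k + suc m))) + m * (m * k) + suc m
    ≤⟨ +-mono-≤ (+-mono-≤ (*-mono-≤ m≤4k (*-mono-≤ m≤4k (+-monoʳ-≤ k (+-monoʳ-≤ k (s≤s m≤4k)))))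
                          (*-mono-≤ m≤4k (*-monoˡ-≤ k m≤4k)))
                (s≤s m≤4k) ⟩
  4 * k * (4 * k * (k + (k + suc (4 * k)))) + 4 * k * (4 * k * k) + suc (4 * k)
    ≡⟨ expand k ⟩
  112 * (k * k * k) + 16 * (k * k) + 4 * k + 1
    ≤⟨ +-mono-≤ (+-mono-≤ (+-mono-≤ (*-monoʳ-≤ 112 k³≤k⁴) (*-monoʳ-≤ 16 k²≤k⁴)) (*-monoʳ-≤ 4 k≤k⁴))
                (≤-trans 1≤k k≤k⁴) ⟩
  112 * (k * k * k * k) + 16 * (k * k * k * k) + 4 * (k * k * k * k) + k * k * k * k
    ≡⟨ collect k ⟩
  133 * k ^ 4 ∎
  where
  open ≤-Reasoning
  k³≤k⁴ : k * k * k ≤ k * k * k * k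
  k³≤k⁴ = m≤m*n (k * k * k) k
  k²≤k⁴ : k * k ≤ k * k * k * k
  k²≤k⁴ = ≤-trans (m≤m*n (k * k) k) k³≤k⁴
  k≤k⁴ : k ≤ k * k * k * k
  k≤k⁴ = ≤-trans (m≤m*n k k) k²≤k⁴
  expand : ∀ x → 4 * x * (4 * x * (x + (x + (1 + 4 * x)))) + 4 * x * (4 * x * x) + (1 + 4 * x)
                 ≡ 112 * (x * x * x) + 16 * (x * x) + 4 * x + 1
  expand = solve-∀
  -- The ring solver does not handle _^_, so k ^ 4 appears unfolded.
  collect : ∀ x → 112 * (x * x * x * x) + 16 * (x * x * x * x) + 4 * (x * x * x * x) + x * x * x * x
                  ≡ 133 * (x * (x * (x * (x * 1))))
  collect = solve-∀

lemma7 : ∃[ c ] (∀ (n : ℕ) (G : Graph n) (k : ℕ) → 1 ≤ k → Reduced G k →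
           (X : VSet n) → TPModulator G X → count X ≤ 4 * k →
           numXNeighbourhoods G X ≤ c * k ^ 4)
lemma7 = 133 , λ n G k 1≤k reduced X tp |X|≤4k →
  let W , distinct , outside , |W|≡ = neighbourhood-representatives G X in
  subst (_≤ 133 * k ^ 4) |W|≡
    (≤-trans (length-representatives≤ G X tp k reduced W distinct outside) (polynomial-bound 1≤k |X|≤4k))
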